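{- Let $n\ge2$ and let $T$ be a triangle of order $n$ all of whose rows $1,\dots,n-1$ are $\mathcal{V}$-rows. Then $T$ is admissible if and only if $T\in\mathcal{T}_n$.
   Context: Let $\mathcal{X}=\{x_i,y_i:1\le i\le n\}$ be formal symbols. For $1\le k\le n-1$, let $\mathcal{V}_k=\{a_{ij},b_{ij}:1\le i<j\le n,\ j-i=k\}$ be formal symbols. A triangle of order $n$ is an array with rows $1,\dots,n$, where row $r$ has $r$ entries at positions $1,\dots,r$. Row $n$ is $1,2,\dots,n$, and the entries of rows $1,\dots,n-1$ lie in $\mathcal{X}\cup\mathcal{V}_1\cup\dots\cup\mathcal{V}_{n-1}$. There is also a notional empty row $0$. A row $r\in\{1,\dots,n-1\}$ is an $\mathcal{X}$-row if all its entries lie in $\mathcal{X}$, and a $\mathcal{V}$-row if all its entries lie in a single $\mathcal{V}_k$; row $0$ counts as both. An arrangement is a triple $(u,v,w)$ such that, for some $2\le e\le n$ and $1\le p\le e-1$, $u$ and $w$ are the entries at positions $p$ and $p+1$ of row $e$ and $v$ is the entry at position $p$ of row $e-1$. An admissible ranking assigns a nonnegative integer rank to each row $0,\dots,n$ such that: - row $n$ has rank $0$ and row $n-1$ has rank $1$; - for each $1\le r\le n-1$, if row $r$ has rank $k$ then either row $r$ is an $\mathcal{X}$-row and row $r-1$ has rank $k$, or all entries of row $r$ lie in $\mathcal{V}_k$ and row $r-1$ has rank $k+1$. Such a ranking is unique if it exists; a triangle with one is called ranked. In a ranked triangle, an entry $u$ in a row of rank $t$ has a left value $l(u)$ and a right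 value $r(u)$: - for $u=a_{ij}$ or $b_{ij}$: $l=i$, $r=j$; - for $u=x_i$: $l=i$, $r=i+t$; - for $u=y_j$: $l=j-t$, $r=j$; - for the integer $u=i$ in row $n$: $l=r=i$. The triangle has the monotone diagonal property if every arrangement $(u,v,w)$ satisfies $l(u)\le l(v)$ and $r(v)\le r(w)$, together with $l(u)<l(v)$ whenever $u$ is some $y_j$ and $r(v)<r(w)$ whenever $w$ is some $x_j$. It has the monotone row property if every arrangement satisfies $l(u)<l(w)$. A triangle is admissible if it is ranked and has both properties. $\mathcal{T}_n$ is the set of tournaments on $\{1,\dots,n\}$, i.e. orientations of the complete graph on that vertex set. A tournament is identified with the triangle of order $n$ whose row $r$ ($1\le r\le n-1$) has at position $i$ ($1\le i\le r$) the symbol $a_{i,i+n-r}$ if the edge between $i$ and $i+n-r$ is oriented from $i$ to $i+n-r$, and the symbol $b_{i,i+n-r}$ if it is oriented from $i+n-r$ to $i$. -}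

module Defs where

open import Data.Nat using (ℕ; zero; suc; _+_; _∸_; _≤_; _<_)
open import Data.Nat.Properties using (_≟_)
open import Data.Integer as ℤ using (ℤ; +_)
open import Data.Bool using (Bool; true; false; if_then_else_)
open import Data.Product using (Σ; _×_)
open import Data.Sum using (_⊎_)
open import Relation.Nullary using (yes; no)
open import Relation.Binary.PropositionalEquality using (_≡_)

data Sym : Set where
  x y : ℕ → Sym
  a b : ℕ → ℕ → Sym

data ValidSym (n : ℕ) : Sym → Set where
  x-ok : ∀ {i} → 1 ≤ i → i ≤ n → ValidSym n (x i)
  y-ok : ∀ {i} → 1 ≤ i → i ≤ n → ValidSym n (y i)
  a-ok : ∀ {i j} → 1 ≤ i → i < j → j ≤ n → ValidSym n (a i j)
  b-ok : ∀ {i j} → 1 ≤ i → i < j → j ≤ n → ValidSym n (b i j)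

data InX : Sym → Set where
  inx : ∀ {i} → InX (x i)
  iny : ∀ {j} → InX (y j)

data InV (n k : ℕ) : Sym → Set where
  ina : ∀ {i j} → 1 ≤ i → i < j → j ≤ n → j ≡ i + k → InV n k (a i j)
  inb : ∀ {i j} → 1 ≤ i → i < j → j ≤ n → j ≡ i + k → InV n k (b i j)

-- Rows 1..n-1 of a triangle: T r p is the entry at row r, position p
-- (only 1 ≤ p ≤ r ≤ n-1 is meaningful). Row n is 1,2,...,n.
Triangle : Set
Triangle = ℕ → ℕ → Sym

IsTriangle : ℕ → Triangle → Set
IsTriangle n T = ∀ r p → 1 ≤ r → r < n → 1 ≤ p → p ≤ r → ValidSym n (T r p)

XRow : Triangle → ℕ → Set
XRow T r = ∀ p → 1 ≤ p → p ≤ r → InX (T r p)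

RowInV : ℕ → ℕ → Triangle → ℕ → Set
RowInV n k T r = ∀ p → 1 ≤ p → p ≤ r → InV n k (T r p)

VRow : ℕ → Triangle → ℕ → Set
VRow n T r = Σ ℕ λ k → RowInV n k T r

data Ent : Set where
  sym : Sym → Ent
  num : ℕ → Ent

entry : ℕ → Triangle → ℕ → ℕ → Ent
entry n T e p with e ≟ n
... | yes _ = num p
... | no _ = sym (T e p)

Ranking : ℕ → Triangle → (ℕ → ℕ) → Set
Ranking n T rk =
  rk n ≡ 0 × rk (n ∸ 1) ≡ 1 ×
  (∀ r → suc r < n →
     (XRow T (suc r) × rk r ≡ rk (suc r))
     ⊎ (RowInV n (rk (suc r)) T (suc r) × rk r ≡ suc (rk (suc r))))

-- left / right values of an entry in a row of rank t
lval : ℕ → Ent → ℤ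
lval t (num i) = + i
lval t (sym (x i)) = + i
lval t (sym (y j)) = + j ℤ.- + t
lval t (sym (a i j)) = + i
lval t (sym (b i j)) = + i

rval : ℕ → Ent → ℤ
rval t (num i) = + i
rval t (sym (x i)) = + i ℤ.+ + t
rval t (sym (y j)) = + j
rval t (sym (a i j)) = + j
rval t (sym (b i j)) = + j

IsXsym : Ent → Set
IsXsym e = Σ ℕ λ j → e ≡ sym (x j)

IsYsym : Ent → Set
IsYsym e = Σ ℕ λ j → e ≡ sym (y j)

MonotoneDiagonal : ℕ → Triangle → (ℕ → ℕ) → Set
MonotoneDiagonal n T rk = ∀ e p → 1 ≤ e → suc e ≤ n → 1 ≤ p → p ≤ e →
  let u = entry n T (suc e) p
      w = entry n T (suc e) (suc p)
      v = entry n T e p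
      t = rk (suc e)
      s = rk e
  in (lval t u ℤ.≤ lval s v) × (rval s v ℤ.≤ rval t w)
     × (IsYsym u → lval t u ℤ.< lval s v)
     × (IsXsym w → rval s v ℤ.< rval t w)

MonotoneRow : ℕ → Triangle → (ℕ → ℕ) → Set
MonotoneRow n T rk = ∀ e p → 1 ≤ e → suc e ≤ n → 1 ≤ p → p ≤ e →
  lval (rk (suc e)) (entry n T (suc e) p) ℤ.< lval (rk (suc e)) (entry n T (suc e) (suc p))

Admissible : ℕ → Triangle → Set
Admissible n T = Σ (ℕ → ℕ) λ rk → Ranking n T rk × MonotoneDiagonal n T rk × MonotoneRow n T rk

-- Tournaments: o i j (for i < j) is true iff the edge is oriented i → j.
Orientation : Set
Orientation = ℕ → ℕ → Bool

tourSym : ℕ → Orientation → ℕ → ℕ → Sym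
tourSym n o r i = if o i (i + (n ∸ r)) then a i (i + (n ∸ r)) else b i (i + (n ∸ r))

InTournaments : ℕ → Triangle → Set
InTournaments n T = Σ Orientation λ o →
  ∀ r p → 1 ≤ r → r < n → 1 ≤ p → p ≤ r → T r p ≡ tourSym n o r p

{-# OPTIONS --safe #-}
module Submission where

open import Defs
open import Data.Nat using (ℕ; zero; suc; _+_; _∸_; _≤_; _<_; z≤n; s≤s)
open import Data.Nat.Properties
open import Data.Integer as ℤ using (+_; +<+)
open import Data.Integer.Properties
  using (drop‿+≤+) renaming (≤-reflexive to ℤ≤-reflexive)
open import Data.Bool using (Bool; true; false; if_then_else_)
open import Data.Product using (_,_; proj₁; proj₂)
open import Data.Sum using (inj₁; inj₂; [_,_]′)
open import Data.Empty using (⊥-elim)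
open import Function.Bundles using (_⇔_; mk⇔)
open import Relation.Nullary using (¬_; yes; no)
open import Relation.Binary.PropositionalEquality
  using (_≡_; refl; trans; cong; subst; subst₂) renaming (sym to ≡-sym)

-- Both conditions amount to the triangle being canonical: the entry in row e,
-- position p is a_{p,p+n-e} or b_{p,p+n-e} (the integer p when e = n).  A
-- canonical triangle is admissible with rank n - r, every diagonal inequality
-- being an equality.  Conversely, with no X-rows the ranking is forced to be
-- n - r, so row e lies in V_{n-e}; going up from row n, the diagonal
-- inequalities l(u) ≤ l(v) and r(v) ≤ r(w) squeeze the symbol v, whose span
-- r(v) - l(v) is n - e, onto [p, p+n-e].

data Spans (i : ℕ) : ℕ → Ent → Set where
  a-spans : ∀ {j} → Spans i j (sym (a i j))
  b-spans : ∀ {j} → Spans i j (sym (b i j))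
  num-spans : Spans i i (num i)

lval-Spans : ∀ {i j E} t → Spans i j E → lval t E ≡ + i
lval-Spans t a-spans = refl
lval-Spans t b-spans = refl
lval-Spans t num-spans = refl

rval-Spans : ∀ {i j E} t → Spans i j E → rval t E ≡ + j
rval-Spans t a-spans = refl
rval-Spans t b-spans = refl
rval-Spans t num-spans = refl

Spans⇒¬IsXsym : ∀ {i j E} → Spans i j E → ¬ IsXsym E
Spans⇒¬IsXsym a-spans (_ , ())
Spans⇒¬IsXsym b-spans (_ , ())
Spans⇒¬IsXsym num-spans (_ , ())

Spans⇒¬IsYsym : ∀ {i j E} → Spans i j E → ¬ IsYsym E
Spans⇒¬IsYsym a-spans (_ , ())
Spans⇒¬IsYsym b-spans (_ , ())
Spans⇒¬IsYsym num-spans (_ , ())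

Spans⇒InV : ∀ {n k i s} → 1 ≤ i → 0 < k → i + k ≤ n →
            Spans i (i + k) (sym s) → InV n k s
Spans⇒InV {i = i} 1≤i 0<k i+k≤n a-spans = ina 1≤i (m<m+n i 0<k) i+k≤n refl
Spans⇒InV {i = i} 1≤i 0<k i+k≤n b-spans = inb 1≤i (m<m+n i 0<k) i+k≤n refl

left-end-squeezed : ∀ {p i k} → + p ℤ.≤ + i → + (i + k) ℤ.≤ + (p + k) → i ≡ p
left-end-squeezed {p} {i} {k} p≤i i+k≤p+k =
  ≤-antisym (+-cancelʳ-≤ k i p (drop‿+≤+ i+k≤p+k)) (drop‿+≤+ p≤i)

InV⇒Spans : ∀ {n k s p t} → InV n k s →
            + p ℤ.≤ lval t (sym s) → rval t (sym s) ℤ.≤ + (p + k) →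
            Spans p (p + k) (sym s)
InV⇒Spans (ina _ _ _ refl) p≤i i+k≤p+k
  with refl ← left-end-squeezed p≤i i+k≤p+k = a-spans
InV⇒Spans (inb _ _ _ refl) p≤i i+k≤p+k
  with refl ← left-end-squeezed p≤i i+k≤p+k = b-spans

InX⇒¬InV : ∀ {n k s} → InX s → ¬ InV n k s
InX⇒¬InV inx ()
InX⇒¬InV iny ()

VRow⇒¬XRow : ∀ {n T r} → 1 ≤ r → VRow n T r → ¬ XRow T r
VRow⇒¬XRow 1≤r (_ , inV) inX = InX⇒¬InV (inX 1 ≤-refl 1≤r) (inV 1 ≤-refl 1≤r)

entry-bottom-row : ∀ n T p → entry n T n p ≡ num p
entry-bottom-row n T p with n ≟ n
... | yes _ = refl
... | no n≢n = ⊥-elim (n≢n refl)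

entry-upper-row : ∀ {n e} T p → e < n → entry n T e p ≡ sym (T e p)
entry-upper-row {n} {e} T p e<n with e ≟ n
... | yes refl = ⊥-elim (<-irrefl refl e<n)
... | no _ = refl

Canonical : ℕ → Triangle → Set
Canonical n T =
  ∀ e p → e ≤ n → 1 ≤ p → p ≤ e → Spans p (p + (n ∸ e)) (entry n T e p)

canonical-upper-row : ∀ {n T e p} → Canonical n T → e < n → 1 ≤ p → p ≤ e →
                      Spans p (p + (n ∸ e)) (sym (T e p))
canonical-upper-row {n} {T} {e} {p} canon e<n 1≤p p≤e =
  subst (Spans p (p + (n ∸ e))) (entry-upper-row T p e<n) (canon e p (<⇒≤ e<n) 1≤p p≤e)

tourSym-Spans : ∀ n o r p → Spans p (p + (n ∸ r)) (sym (tourSym n o r p))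
tourSym-Spans n o r p with o p (p + (n ∸ r))
... | true = a-spans
... | false = b-spans

tournament⇒canonical : ∀ {n T} → InTournaments n T → Canonical n T
tournament⇒canonical {n} {T} (o , T≡tourSym) e p e≤n 1≤p p≤e
  with m≤n⇒m<n∨m≡n e≤n
... | inj₁ e<n
  rewrite entry-upper-row T p e<n | T≡tourSym e p (≤-trans 1≤p p≤e) e<n 1≤p p≤e =
  tourSym-Spans n o e p
... | inj₂ refl rewrite entry-bottom-row n T p | n∸n≡0 n | +-identityʳ p = num-spans

isA : Sym → Bool
isA (a _ _) = true
isA _ = false

Spans⇒≡if-isA : ∀ {i j s} → Spans i j (sym s) → s ≡ (if isA s then a i j else b i j)
Spans⇒≡if-isA a-spans = refl
Spans⇒≡if-isA b-spans = refl

orientation : ℕ → Triangle → Orientation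
orientation n T i j = isA (T (n ∸ (j ∸ i)) i)

orientation-reads-row : ∀ {n} T r p → r ≤ n →
                        orientation n T p (p + (n ∸ r)) ≡ isA (T r p)
orientation-reads-row {n} T r p r≤n =
  cong (λ q → isA (T q p))
       (trans (cong (n ∸_) (m+n∸m≡n p (n ∸ r))) (m∸[m∸n]≡n r≤n))

canonical⇒tournament : ∀ {n T} → Canonical n T → InTournaments n T
canonical⇒tournament {n} {T} canon = orientation n T , T≡tourSym
  where
  T≡tourSym : ∀ r p → 1 ≤ r → r < n → 1 ≤ p → p ≤ r →
              T r p ≡ tourSym n (orientation n T) r p
  T≡tourSym r p _ r<n 1≤p p≤r =
    trans (Spans⇒≡if-isA (canonical-upper-row canon r<n 1≤p p≤r))
          (cong (λ β → if β then a p (p + (n ∸ r)) else b p (p + (n ∸ r)))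
                (≡-sym (orientation-reads-row T r p (<⇒≤ r<n))))

canonical⇒admissible : ∀ {n T} → 1 ≤ n → Canonical n T → Admissible n T
canonical⇒admissible {n} {T} 1≤n canon = (n ∸_) , ranking , diagonal , row
  where
  upper-row-in-V : ∀ r → suc r < n → RowInV n (n ∸ suc r) T (suc r)
  upper-row-in-V r r<n p 1≤p p≤r =
    Spans⇒InV 1≤p (m<n⇒0<n∸m r<n)
      (≤-trans (+-monoˡ-≤ (n ∸ suc r) p≤r) (≤-reflexive (m+[n∸m]≡n (<⇒≤ r<n))))
      (canonical-upper-row canon r<n 1≤p p≤r)

  ranking : Ranking n T (n ∸_)
  ranking = n∸n≡0 n , m∸[m∸n]≡n 1≤n ,
            λ r r<n → inj₂ (upper-row-in-V r r<n , +-∸-assoc 1 (<⇒≤ r<n))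

  diagonal : MonotoneDiagonal n T (n ∸_)
  diagonal e p _ e<n 1≤p p≤e =
    ℤ≤-reflexive (trans (lval-Spans _ u) (≡-sym (lval-Spans _ v))) ,
    ℤ≤-reflexive (trans (rval-Spans _ v)
                        (trans (cong +_ right-ends) (≡-sym (rval-Spans _ w)))) ,
    (λ u-is-y → ⊥-elim (Spans⇒¬IsYsym u u-is-y)) ,
    (λ w-is-x → ⊥-elim (Spans⇒¬IsXsym w w-is-x))
    where
    u : Spans p (p + (n ∸ suc e)) (entry n T (suc e) p)
    u = canon (suc e) p e<n 1≤p (m≤n⇒m≤1+n p≤e)
    w : Spans (suc p) (suc p + (n ∸ suc e)) (entry n T (suc e) (suc p))
    w = canon (suc e) (suc p) e<n (s≤s z≤n) (s≤s p≤e)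
    v : Spans p (p + (n ∸ e)) (entry n T e p)
    v = canon e p (<⇒≤ e<n) 1≤p p≤e
    right-ends : p + (n ∸ e) ≡ suc p + (n ∸ suc e)
    right-ends = trans (cong (λ k → p + k) (+-∸-assoc 1 e<n)) (+-suc p (n ∸ suc e))

  row : MonotoneRow n T (n ∸_)
  row e p _ e<n 1≤p p≤e =
    subst₂ ℤ._<_ (≡-sym (lval-Spans _ (canon (suc e) p e<n 1≤p (m≤n⇒m≤1+n p≤e))))
                 (≡-sym (lval-Spans _ (canon (suc e) (suc p) e<n (s≤s z≤n) (s≤s p≤e))))
                 (+<+ (n<1+n p))

NoXRows : ℕ → Triangle → Set
NoXRows n T = ∀ r → 1 ≤ r → r < n → ¬ XRow T r

ranking⇒rank≡ : ∀ {n T rk} → Ranking n T rk → NoXRows n T →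
                ∀ s m → s + m ≡ n → 0 < m → rk s ≡ m
ranking⇒rank≡ {n} {rk = rk} (_ , rk[n∸1]≡1 , _) _ s 1 s+1≡n _ =
  trans (cong rk (trans (≡-sym (m+n∸n≡m s 1)) (cong (_∸ 1) s+1≡n))) rk[n∸1]≡1
ranking⇒rank≡ {n} ranking@(_ , _ , step) noXRow s (suc (suc m)) s+m+2≡n _ =
  [ (λ (xRow , _) → ⊥-elim (noXRow (suc s) (s≤s z≤n) 1+s<n xRow))
  , (λ (_ , rk-s≡1+rk-1+s) →
       trans rk-s≡1+rk-1+s
             (cong suc (ranking⇒rank≡ ranking noXRow (suc s) (suc m) 1+s+m+1≡n (s≤s z≤n))))
  ]′ (step s 1+s<n)
  where
  1+s+m+1≡n : suc s + suc m ≡ n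
  1+s+m+1≡n = trans (≡-sym (+-suc s (suc m))) s+m+2≡n
  1+s<n : suc s < n
  1+s<n = subst (suc s <_) 1+s+m+1≡n (m<m+n (suc s) (s≤s z≤n))

ranking⇒rows-in-V : ∀ {n T rk} → Ranking n T rk → NoXRows n T →
                    ∀ r → 1 ≤ r → r < n → RowInV n (n ∸ r) T r
ranking⇒rows-in-V {n} {T} ranking@(_ , _ , step) noXRow (suc r) _ r<n with step r r<n
... | inj₁ (xRow , _) = ⊥-elim (noXRow (suc r) (s≤s z≤n) r<n xRow)
... | inj₂ (inV , _) =
  subst (λ k → RowInV n k T (suc r))
        (ranking⇒rank≡ ranking noXRow (suc r) (n ∸ suc r)
                       (m+[n∸m]≡n (<⇒≤ r<n)) (m<n⇒0<n∸m r<n))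
        inV

monotoneDiagonal⇒canonical : ∀ {n T rk} →
                             (∀ r → 1 ≤ r → r < n → RowInV n (n ∸ r) T r) →
                             MonotoneDiagonal n T rk → Canonical n T
monotoneDiagonal⇒canonical {n} {T} {rk} rows-in-V diagonal e p e≤n =
  spans-at-height (n ∸ e) e (m+[n∸m]≡n e≤n) p
  where
  spans-at-height : ∀ m e → e + m ≡ n → ∀ p → 1 ≤ p → p ≤ e →
                    Spans p (p + m) (entry n T e p)
  spans-at-height zero e e+0≡n p _ _ with refl ← trans (≡-sym (+-identityʳ e)) e+0≡n
    rewrite entry-bottom-row n T p | +-identityʳ p = num-spans
  spans-at-height (suc m) e e+m+1≡n p 1≤p p≤e =
    subst (Spans p (p + suc m)) (≡-sym (entry-upper-row T p e<n))
          (InV⇒Spans v∈V left-bound right-bound)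
    where
    1+e+m≡n : suc e + m ≡ n
    1+e+m≡n = trans (≡-sym (+-suc e m)) e+m+1≡n
    e<n : e < n
    e<n = subst (e <_) e+m+1≡n (m<m+n e (s≤s z≤n))
    1≤e : 1 ≤ e
    1≤e = ≤-trans 1≤p p≤e
    u : Spans p (p + m) (entry n T (suc e) p)
    u = spans-at-height m (suc e) 1+e+m≡n p 1≤p (m≤n⇒m≤1+n p≤e)
    w : Spans (suc p) (suc p + m) (entry n T (suc e) (suc p))
    w = spans-at-height m (suc e) 1+e+m≡n (suc p) (s≤s z≤n) (s≤s p≤e)
    v∈V : InV n (suc m) (T e p)
    v∈V = subst (λ k → InV n k (T e p))
                (trans (cong (_∸ e) (≡-sym e+m+1≡n)) (m+n∸m≡n e (suc m)))
                (rows-in-V e 1≤e e<n p 1≤p p≤e)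
    left-bound : + p ℤ.≤ lval (rk e) (sym (T e p))
    left-bound = subst₂ ℤ._≤_ (lval-Spans _ u) (cong (lval (rk e)) (entry-upper-row T p e<n))
                       (proj₁ (diagonal e p 1≤e e<n 1≤p p≤e))
    right-bound : rval (rk e) (sym (T e p)) ℤ.≤ + (p + suc m)
    right-bound = subst₂ ℤ._≤_ (cong (rval (rk e)) (entry-upper-row T p e<n))
                        (trans (rval-Spans _ w) (cong +_ (≡-sym (+-suc p m))))
                        (proj₁ (proj₂ (diagonal e p 1≤e e<n 1≤p p≤e)))

lemma3 : (n : ℕ) → 2 ≤ n → (T : Triangle) → IsTriangle n T →
    (∀ r → 1 ≤ r → r < n → VRow n T r) →
    (Admissible n T ⇔ InTournaments n T)
lemma3 n 2≤n T _ V-rows = mk⇔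
  (λ (_ , ranking , diagonal , _) →
     canonical⇒tournament
       (monotoneDiagonal⇒canonical (ranking⇒rows-in-V ranking noXRow) diagonal))
  (λ tournament →
     canonical⇒admissible (≤-trans (s≤s z≤n) 2≤n) (tournament⇒canonical tournament))
  where
  noXRow : NoXRows n T
  noXRow r 1≤r r<n = VRow⇒¬XRow {T = T} 1≤r (V-rows r 1≤r r<n)
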